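{- As $n\to\infty$, \[ \limsup_{r\to+\infty}\frac{\mathsf{D}(C_2^{r-1}\oplus C_{2n})}{r} \lesssim 2\log 2\,\frac{n}{\log n}. \]
   Context: $C_m$ denotes the cyclic group of order $m$ and $C_2^{r-1}$ the elementary abelian $2$-group of rank $r-1$. For a finite abelian group $G$, the Davenport constant $\mathsf{D}(G)$ is the smallest integer $\ell$ such that every sequence (finite list, repetitions allowed) of elements of $G$ of length at least $\ell$ has a non-empty subsequence whose terms sum to $0$. For positive functions $a(n),b(n)$, $a(n)\lesssim b(n)$ as $n\to\infty$ means $\limsup_{n\to\infty} a(n)/b(n)\le 1$. $\log$ is the natural logarithm. -}

module Defs where

open import Data.Nat using (ℕ; _+_; _*_; _∸_; _≤_)
open import Data.Nat.Divisibility using (_∣_)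
open import Data.Fin using (Fin; toℕ)
open import Data.Vec using (Vec; lookup)
open import Data.List using (List; []; map; length)
open import Data.Nat.ListAction using (sum)
open import Data.List.Relation.Binary.Sublist.Propositional using (_⊆_)
open import Data.Product using (_×_; proj₁; proj₂; ∃-syntax)
open import Relation.Binary.PropositionalEquality using (_≢_)

Elem : ℕ → ℕ → Set
Elem r n = Vec (Fin 2) (r ∸ 1) × Fin (2 * n)

ZeroSum : (r n : ℕ) → List (Elem r n) → Set
ZeroSum r n xs =
  ((i : Fin (r ∸ 1)) → 2 ∣ sum (map (λ x → toℕ (lookup (proj₁ x) i)) xs))
  × (2 * n ∣ sum (map (λ x → toℕ (proj₂ x)) xs))

HasZeroSumSubseq : (r n : ℕ) → List (Elem r n) → Set
HasZeroSumSubseq r n xs = ∃[ ys ] (ys ⊆ xs × ys ≢ [] × ZeroSum r n ys)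

ZSProperty : (r n ℓ : ℕ) → Set
ZSProperty r n ℓ = (xs : List (Elem r n)) → ℓ ≤ length xs → HasZeroSumSubseq r n xs

IsDavenport : (r n ℓ : ℕ) → Set
IsDavenport r n ℓ = ZSProperty r n ℓ × ((m : ℕ) → ZSProperty r n m → ℓ ≤ m)

-- Read an element of C_2^{r-1} ⊕ C_{2n} as r integer coordinates, one of them from C_{2n}. Given t·2^k
-- terms with r < kt, split them into t groups of 2^k and choose one term per group: of the 2^{kt} > 2^r
-- choices two have the same coordinatewise parities, and their symmetric difference is a nonempty block
-- of at most 2t terms all of whose coordinate sums are even. From n·2t + t·2^k terms one greedily
-- extracts n disjoint blocks; two of the n + 1 prefix sums of their halved C_{2n}-sums agree mod n, so a
-- run of consecutive blocks sums to 0. Thus D ≤ (⌊r/k⌋ + 1)(2n + 2^k), and k ≈ (b+1)/(a+b+2) · log₂ n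
-- makes 2^k negligible against n/log n, which after exponentiating base n ≈ 2^x is the stated bound.

module Submission where

open import Defs
open import Data.Nat using (ℕ; zero; suc; _+_; _*_; _∸_; _^_; _≤_; _<_; z≤n; s≤s; s≤s⁻¹; _%_; _/_; NonZero; >-nonZero; _<?_)
open import Data.Nat.Properties hiding (suc-injective)
open import Data.Nat.DivMod using (_mod_; %-distribˡ-+; m*n%n≡0; m%n<n; m≡m%n+[m/n]*n; m*[n/m]≡n; m/n*n≤m)
open import Data.Nat.Divisibility using (_∣_; divides; _∣0; m%n≡0⇒n∣m; ∣m+n∣m⇒∣n; ∣m∣n⇒∣m+n; m∣m*n; *-monoʳ-∣)
open import Data.Nat.ListAction using (sum)
open import Data.Nat.Tactic.RingSolver using (solve-∀)
open import Data.Bool using (Bool; true; false; _∧_; _∨_; not; _xor_; if_then_else_)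
open import Data.Bool.Properties using (∧-zeroʳ)
open import Data.Fin using (Fin; zero; suc; toℕ; combine; finToFun; funToFin)
open import Data.Fin.Properties
  using (pigeonhole; ¬∀⟶∃¬; finToFun-funToFin; funToFin-finToFin; combine-injective; toℕ-fromℕ<; toℕ<n; suc-injective)
  renaming (_≟_ to _≟ᶠ_; <⇒≢ to <⇒≢ᶠ)
import Data.Vec as Vec
open import Data.List using (List; []; _∷_; map; length; lookup)
open import Data.List.Relation.Binary.Sublist.Propositional using (_⊆_; []; _∷_; _∷ʳ_)
open import Data.Product using (∃; ∃₂; ∃-syntax; Σ; _×_; _,_; proj₁; proj₂)
open import Function using (_∘_)
open import Function.Definitions using (Injective)
open import Relation.Binary.PropositionalEquality
open import Relation.Binary.Definitions using (tri<; tri≈; tri>)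
open import Relation.Nullary using (¬_; contradiction)
open import Relation.Nullary.Decidable using (Dec; does; yes; no; dec-true; dec-false)
open import Algebra.Properties.Semiring.Sum +-*-semiring
  using (∑-distrib-+; *-distribˡ-sum; sum-cong-≗; sum-replicate-zero) renaming (sum to ∑)

dec-true⁻¹ : ∀ {A : Set} (a? : Dec A) → does a? ≡ true → A
dec-true⁻¹ (yes a) _ = a

Mask : ℕ → Set
Mask L = Fin L → Bool

module _ {L : ℕ} where

  infix  4 _⊑_
  infixr 7 _∩_
  infixr 6 _∪_ _△_ _∖_

  _⊑_ : Mask L → Mask L → Set
  A ⊑ B = ∀ p → A p ≡ true → B p ≡ true

  Nonempty : Mask L → Set
  Nonempty M = ∃ λ p → M p ≡ true

  ∑⟨_⟩ : Mask L → (Fin L → ℕ) → ℕ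
  ∑⟨ M ⟩ g = ∑ λ p → if M p then g p else 0

  size : Mask L → ℕ
  size M = ∑⟨ M ⟩ λ _ → 1

  _∩_ _∪_ _△_ _∖_ : Mask L → Mask L → Mask L
  (A ∩ B) p = A p ∧ B p
  (A ∪ B) p = A p ∨ B p
  (A △ B) p = A p xor B p
  (A ∖ B) p = A p ∧ not (B p)

  ⁅_⁆ : Fin L → Mask L
  ⁅ q ⁆ p = does (q ≟ᶠ p)

  ⊑-trans : ∀ {A B C : Mask L} → A ⊑ B → B ⊑ C → A ⊑ C
  ⊑-trans A⊑B B⊑C p = B⊑C p ∘ A⊑B p

  ≗⇒⊑ : ∀ {A B : Mask L} → A ≗ B → A ⊑ B
  ≗⇒⊑ A≗B p = trans (sym (A≗B p))

  ∖-⊑ : ∀ {A B : Mask L} → A ∖ B ⊑ A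
  ∖-⊑ {A} p with A p
  ... | true = λ _ → refl

  ∖-∌ : ∀ {A B : Mask L} p → B p ≡ true → (A ∖ B) p ≡ false
  ∖-∌ {A} p p∈B rewrite p∈B = ∧-zeroʳ (A p)

  ∑-cong-+ : {f g h k : Fin L → ℕ} → (∀ p → f p + g p ≡ h p + k p) → ∑ f + ∑ g ≡ ∑ h + ∑ k
  ∑-cong-+ {f} {g} {h} {k} e = trans (sym (∑-distrib-+ f g)) (trans (sum-cong-≗ e) (∑-distrib-+ h k))

  ∑⟨⟩-cong : ∀ {A B : Mask L} g → A ≗ B → ∑⟨ A ⟩ g ≡ ∑⟨ B ⟩ g
  ∑⟨⟩-cong g e = sum-cong-≗ λ p → cong (λ b → if b then g p else 0) (e p)

  ∑⟨△⟩ : ∀ A B g → 2 * ∑⟨ A ∩ B ⟩ g + ∑⟨ A △ B ⟩ g ≡ ∑⟨ A ⟩ g + ∑⟨ B ⟩ g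
  ∑⟨△⟩ A B g =
    trans (cong (_+ ∑⟨ A △ B ⟩ g) (*-distribˡ-sum 2 λ p → if A p ∧ B p then g p else 0))
          (∑-cong-+ λ p → point (A p) (B p) (g p))
    where
    point : ∀ a b x → 2 * (if a ∧ b then x else 0) + (if a xor b then x else 0)
                    ≡ (if a then x else 0) + (if b then x else 0)
    point true  true  x = trans (+-identityʳ (2 * x)) (cong (x +_) (+-identityʳ x))
    point true  false x = sym (+-identityʳ x)
    point false true  x = refl
    point false false x = refl

  ∑⟨∪⟩ : ∀ A B g → ∑⟨ A ∪ B ⟩ g + ∑⟨ A ∩ B ⟩ g ≡ ∑⟨ A ⟩ g + ∑⟨ B ⟩ g
  ∑⟨∪⟩ A B g = ∑-cong-+ λ p → point (A p) (B p) (g p)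
    where
    point : ∀ a b x → (if a ∨ b then x else 0) + (if a ∧ b then x else 0)
                    ≡ (if a then x else 0) + (if b then x else 0)
    point true  true  x = refl
    point true  false x = refl
    point false true  x = +-identityʳ x
    point false false x = refl

  ∑⟨∖⟩ : ∀ A B g → B ⊑ A → ∑⟨ B ⟩ g + ∑⟨ A ∖ B ⟩ g ≡ ∑⟨ A ⟩ g
  ∑⟨∖⟩ A B g B⊑A =
    trans (sym (∑-distrib-+ (λ p → if B p then g p else 0) (λ p → if (A ∖ B) p then g p else 0)))
          (sum-cong-≗ λ p → point (A p) (B p) (g p) (B⊑A p))
    where
    point : ∀ a b x → (b ≡ true → a ≡ true) →
            (if b then x else 0) + (if a ∧ not b then x else 0) ≡ (if a then x else 0)
    point true  true  x _ = +-identityʳ x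
    point true  false x _ = refl
    point false true  x b⇒a with () ← b⇒a refl
    point false false x _ = refl

  size-∪ : ∀ A B → size (A ∪ B) ≤ size A + size B
  size-∪ A B = subst (size (A ∪ B) ≤_) (∑⟨∪⟩ A B _) (m≤m+n _ (size (A ∩ B)))

  size-△ : ∀ A B → size (A △ B) ≤ size A + size B
  size-△ A B = subst (size (A △ B) ≤_) (∑⟨△⟩ A B _) (m≤n+m _ (2 * size (A ∩ B)))

size-⁅⁆ : ∀ {L} (q : Fin L) → size ⁅ q ⁆ ≡ 1
size-⁅⁆ {suc L} zero    = cong suc (sum-replicate-zero L)
size-⁅⁆ {suc L} (suc q) = size-⁅⁆ q

size-full : ∀ {L} → size {L} (λ _ → true) ≡ L
size-full {zero}  = refl
size-full {suc L} = cong suc (size-full {L})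

image : ∀ {t L} → (Fin t → Fin L) → Mask L
image {zero}  P _ = false
image {suc t} P = ⁅ P zero ⁆ ∪ image (P ∘ suc)

image-⁻¹ : ∀ {t L} (P : Fin t → Fin L) p → image P p ≡ true → ∃ λ j → P j ≡ p
image-⁻¹ {suc t} P p eq with P zero ≟ᶠ p
... | yes P₀≡p = zero , P₀≡p
... | no _ with j , Pj≡p ← image-⁻¹ (P ∘ suc) p eq = suc j , Pj≡p

image-∋ : ∀ {t L} (P : Fin t → Fin L) j → image P (P j) ≡ true
image-∋ P zero    rewrite dec-true (P zero ≟ᶠ P zero) refl = refl
image-∋ P (suc j) with does (P zero ≟ᶠ P (suc j))
... | true  = refl
... | false = image-∋ (P ∘ suc) j

size-image : ∀ {t L} (P : Fin t → Fin L) → size (image P) ≤ t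
size-image {zero} {L} P = ≤-reflexive (sum-replicate-zero L)
size-image {suc t} P = ≤-trans (size-∪ ⁅ P zero ⁆ (image (P ∘ suc)))
                               (+-mono-≤ (≤-reflexive (size-⁅⁆ (P zero))) (size-image (P ∘ suc)))

funToFin-cong : ∀ {m n} {f g : Fin m → Fin n} → (∀ i → f i ≡ g i) → funToFin f ≡ funToFin g
funToFin-cong {zero}  f≗g = refl
funToFin-cong {suc m} f≗g = cong₂ combine (f≗g zero) (funToFin-cong (f≗g ∘ suc))

pigeonhole-→ : ∀ {p q m n} → n ^ m < p ^ q → (F : (Fin q → Fin p) → Fin m → Fin n) →
               ∃₂ λ c c′ → (∃ λ j → c j ≢ c′ j) × (∀ i → F c i ≡ F c′ i)
pigeonhole-→ {p} {q} lt F with z , z′ , z<z′ , eq ← pigeonhole lt (funToFin ∘ F ∘ finToFun) =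
  c , c′ , ¬∀⟶∃¬ q _ (λ j → c j ≟ᶠ c′ j) c≢c′ , λ i →
    trans (sym (finToFun-funToFin (F c) i)) (trans (cong (λ z → finToFun z i) eq) (finToFun-funToFin (F c′) i))
  where
  c c′ : Fin q → Fin p
  c  = finToFun z
  c′ = finToFun z′
  c≢c′ : ¬ (∀ j → c j ≡ c′ j)
  c≢c′ c≗c′ = <⇒≢ᶠ z<z′ (trans (sym (funToFin-finToFin {q} {p} z))
                               (trans (funToFin-cong c≗c′) (funToFin-finToFin {q} {p} z′)))

enumerate : ∀ {L K} (U : Mask L) → K ≤ size U →
            Σ (Fin K → Fin L) λ e → Injective _≡_ _≡_ e × (∀ i → U (e i) ≡ true)
enumerate {K = zero} U _ = (λ ()) , (λ { {()} }) , (λ ())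
enumerate {suc L} {suc K} U K<size with U zero in U₀
... | true  with e , e-inj , e∈U ← enumerate (U ∘ suc) (s≤s⁻¹ K<size) = e′ , e′-inj , e′∈U
  where
  e′ : Fin (suc K) → Fin (suc L)
  e′ zero    = zero
  e′ (suc i) = suc (e i)
  e′-inj : Injective _≡_ _≡_ e′
  e′-inj {zero}  {zero}  _ = refl
  e′-inj {suc i} {suc j} eq = cong suc (e-inj (suc-injective eq))
  e′∈U : ∀ i → U (e′ i) ≡ true
  e′∈U zero    = U₀
  e′∈U (suc i) = e∈U i
... | false with e , e-inj , e∈U ← enumerate (U ∘ suc) K<size = suc ∘ e , e-inj ∘ suc-injective , e∈U

mod≡⇒%≡ : ∀ m o n .{{_ : NonZero n}} → m mod n ≡ o mod n → m % n ≡ o % n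
mod≡⇒%≡ m o n eq = trans (sym (toℕ-fromℕ< (m%n<n m n))) (trans (cong toℕ eq) (toℕ-fromℕ< (m%n<n o n)))

m%2≡n%2⇒2∣m+n : ∀ m n → m % 2 ≡ n % 2 → 2 ∣ m + n
m%2≡n%2⇒2∣m+n m n eq = m%n≡0⇒n∣m (m + n) 2 (begin
  (m + n) % 2           ≡⟨ %-distribˡ-+ m n 2 ⟩
  (m % 2 + n % 2) % 2   ≡⟨ cong (λ x → (m % 2 + x) % 2) (sym eq) ⟩
  (m % 2 + m % 2) % 2   ≡⟨ cong (_% 2) (sym (trans (*-comm (m % 2) 2) (cong (m % 2 +_) (+-identityʳ (m % 2))))) ⟩
  (m % 2 * 2) % 2       ≡⟨ m*n%n≡0 (m % 2) 2 ⟩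
  0                     ∎)
  where
  open ≡-Reasoning

∑⟨△⟩-even : ∀ {L} (A B : Mask L) g → ∑⟨ A ⟩ g mod 2 ≡ ∑⟨ B ⟩ g mod 2 → 2 ∣ ∑⟨ A △ B ⟩ g
∑⟨△⟩-even A B g eq =
  ∣m+n∣m⇒∣n (subst (2 ∣_) (sym (∑⟨△⟩ A B g))
                    (m%2≡n%2⇒2∣m+n (∑⟨ A ⟩ g) (∑⟨ B ⟩ g) (mod≡⇒%≡ (∑⟨ A ⟩ g) (∑⟨ B ⟩ g) 2 eq)))
             (m∣m*n (∑⟨ A ∩ B ⟩ g))

2^w<[2^k]^t : ∀ {w k t} → w < k * t → 2 ^ w < (2 ^ k) ^ t
2^w<[2^k]^t {w} {k} {t} w<kt = subst (2 ^ w <_) (sym (^-*-assoc 2 k t)) (^-monoʳ-< 2 (s≤s (s≤s z≤n)) w<kt)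

size-∖-≥ : ∀ {L s j c} (U B : Mask L) → B ⊑ U → size B ≤ s →
           suc j * s + c ≤ size U → j * s + c ≤ size (U ∖ B)
size-∖-≥ {s = s} {j} {c} U B B⊑U size-B big = +-cancelˡ-≤ s _ _ (begin
  s + (j * s + c)        ≡⟨ +-assoc s (j * s) c ⟨
  suc j * s + c          ≤⟨ big ⟩
  size U                 ≡⟨ ∑⟨∖⟩ U B _ B⊑U ⟨
  size B + size (U ∖ B)  ≤⟨ +-monoˡ-≤ (size (U ∖ B)) size-B ⟩
  s + size (U ∖ B)       ∎)
  where open ≤-Reasoning

block : ∀ {L} → (Fin L → ℕ) → ℕ → Mask L
block lab q p = does (lab p ≟ q)

module _ {L w : ℕ} (val : Fin L → Fin w → ℕ) where

  EvenOn : Mask L → Set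
  EvenOn M = ∀ i → 2 ∣ ∑⟨ M ⟩ λ p → val p i

  -- The t·m positions enumerated by e form t groups of m; a choice c takes member c j of group j.
  module Choices {t m : ℕ} (e : Fin (t * m) → Fin L) where

    choice : (Fin t → Fin m) → Fin t → Fin L
    choice c j = e (combine j (c j))

    chosen : (Fin t → Fin m) → Mask L
    chosen c = image (choice c)

    parity : (Fin t → Fin m) → Fin w → Fin 2
    parity c i = ∑⟨ chosen c ⟩ (λ p → val p i) mod 2

  short-even-block : ∀ t k (U : Mask L) → w < k * t → t * 2 ^ k ≤ size U →
                     ∃ λ B → B ⊑ U × size B ≤ 2 * t × Nonempty B × EvenOn B
  short-even-block t k U w<kt big
    with e , e-inj , e∈U ← enumerate U big
    with c₁ , c₂ , (j₀ , c₁j₀≢c₂j₀) , same-parity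
           ← pigeonhole-→ (2^w<[2^k]^t {w} {k} {t} w<kt) (Choices.parity {t} {2 ^ k} e)
    = B , B⊑U , size-B , (p₀ , B∋p₀) , B-even
    where
    open Choices {t} {2 ^ k} e
    B : Mask L
    B = chosen c₁ △ chosen c₂
    chosen⊑U : ∀ c → chosen c ⊑ U
    chosen⊑U c p p∈ with j , refl ← image-⁻¹ (choice c) p p∈ = e∈U _
    B⊑U : B ⊑ U
    B⊑U p p∈B with chosen c₁ p in p∈₁
    ... | true  = chosen⊑U c₁ p p∈₁
    ... | false = chosen⊑U c₂ p p∈B
    size-B : size B ≤ 2 * t
    size-B = begin
      size B                             ≤⟨ size-△ (chosen c₁) (chosen c₂) ⟩
      size (chosen c₁) + size (chosen c₂) ≤⟨ +-mono-≤ (size-image (choice c₁)) (size-image (choice c₂)) ⟩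
      t + t                              ≡⟨ cong (t +_) (+-identityʳ t) ⟨
      2 * t                              ∎
      where open ≤-Reasoning
    p₀ : Fin L
    p₀ = choice c₁ j₀
    p₀∉chosen₂ : chosen c₂ p₀ ≡ false
    p₀∉chosen₂ with chosen c₂ p₀ in p₀∈₂
    ... | false = refl
    ... | true
      with j , e≡ ← image-⁻¹ (choice c₂) p₀ p₀∈₂
      with refl , c₂j≡c₁j₀ ← combine-injective j _ j₀ _ (e-inj e≡)
      = contradiction (sym c₂j≡c₁j₀) c₁j₀≢c₂j₀
    B∋p₀ : B p₀ ≡ true
    B∋p₀ rewrite image-∋ (choice c₁) j₀ | p₀∉chosen₂ = refl
    B-even : EvenOn B
    B-even i = ∑⟨△⟩-even (chosen c₁) (chosen c₂) (λ p → val p i) (same-parity i)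

  Good : Mask L → Set
  Good B = Nonempty B × EvenOn B

  Good-cong : ∀ {A B} → A ≗ B → Good A → Good B
  Good-cong A≗B ((p , p∈A) , A-even) =
    (p , trans (sym (A≗B p)) p∈A) , λ i → subst (2 ∣_) (∑⟨⟩-cong (λ p → val p i) A≗B) (A-even i)

  good-blocks : ∀ t k → w < k * t → ∀ j (U : Mask L) → j * (2 * t) + t * 2 ^ k ≤ size U →
                ∃ λ lab → ∀ q → q < j → block lab q ⊑ U × Good (block lab q)
  good-blocks t k w<kt zero    U _   = (λ _ → 0) , λ _ ()
  good-blocks t k w<kt (suc j) U big
    with B , B⊑U , size-B , B-nonempty , B-even ← short-even-block t k U w<kt (≤-trans (m≤n+m _ _) big)
    with lab , lab-good ← good-blocks t k w<kt j (U ∖ B) (size-∖-≥ {j = j} U B B⊑U size-B big)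
    = lab′ , good′
    where
    lab′ : Fin L → ℕ
    lab′ p = if B p then 0 else suc (lab p)
    block₀ : ∀ p → block lab′ 0 p ≡ B p
    block₀ p with B p
    ... | true  = refl
    ... | false = refl
    block-suc : ∀ q → q < j → ∀ p → block lab′ (suc q) p ≡ block lab q p
    block-suc q q<j p with B p in p∈B | block lab q p in p∈q
    ... | false | _     = p∈q
    ... | true  | false = refl
    ... | true  | true  with () ← trans (sym (∖-∌ {A = U} {B} p p∈B)) (proj₁ (lab-good q q<j) p p∈q)
    good′ : ∀ q → q < suc j → block lab′ q ⊑ U × Good (block lab′ q)
    good′ zero    _    = ⊑-trans (≗⇒⊑ block₀) B⊑U , Good-cong (sym ∘ block₀) (B-nonempty , B-even)
    good′ (suc q) q<sj with ⊑U∖B , good ← lab-good q (s≤s⁻¹ q<sj) =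
      ⊑-trans (≗⇒⊑ (block-suc q q<j)) (⊑-trans ⊑U∖B ∖-⊑) , Good-cong (sym ∘ block-suc q q<j) good
      where q<j = s≤s⁻¹ q<sj

m%n≡o%n⇒n∣o∸m : ∀ m o n .{{_ : NonZero n}} → m % n ≡ o % n → n ∣ o ∸ m
m%n≡o%n⇒n∣o∸m m o n eq = divides (o / n ∸ m / n) (begin
  o ∸ m                                    ≡⟨ cong₂ _∸_ (m≡m%n+[m/n]*n o n) (m≡m%n+[m/n]*n m n) ⟩
  (o % n + o / n * n) ∸ (m % n + m / n * n) ≡⟨ cong (λ x → (o % n + o / n * n) ∸ (x + m / n * n)) eq ⟩
  (o % n + o / n * n) ∸ (o % n + m / n * n) ≡⟨ [m+n]∸[m+o]≡n∸o (o % n) _ _ ⟩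
  o / n * n ∸ m / n * n                    ≡⟨ *-distribʳ-∸ n (o / n) (m / n) ⟨
  (o / n ∸ m / n) * n                      ∎)
  where open ≡-Reasoning

pigeonhole-% : ∀ n .{{_ : NonZero n}} (h : ℕ → ℕ) → ∃₂ λ a b → a < b × b ≤ n × h a % n ≡ h b % n
pigeonhole-% n h with i , j , i<j , eq ← pigeonhole (n<1+n n) (λ (j : Fin (suc n)) → h (toℕ j) mod n) =
  toℕ i , toℕ j , i<j , s≤s⁻¹ (toℕ<n j) , mod≡⇒%≡ (h (toℕ i)) (h (toℕ j)) n eq

below : ∀ {L} → (Fin L → ℕ) → ℕ → Mask L
below lab j p = does (lab p <? j)

∑⟨below-suc⟩ : ∀ {L} (lab : Fin L → ℕ) j g → ∑⟨ below lab (suc j) ⟩ g ≡ ∑⟨ below lab j ⟩ g + ∑⟨ block lab j ⟩ g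
∑⟨below-suc⟩ lab j g =
  trans (sum-cong-≗ λ p → point (lab p) (g p))
        (∑-distrib-+ (λ p → if below lab j p then g p else 0) (λ p → if block lab j p then g p else 0))
  where
  point : ∀ l x → (if does (l <? suc j) then x else 0)
                ≡ (if does (l <? j) then x else 0) + (if does (l ≟ j) then x else 0)
  point l x with <-cmp l j
  ... | tri< l<j _ _
    rewrite dec-true (l <? suc j) (m<n⇒m<1+n l<j) | dec-true (l <? j) l<j | dec-false (l ≟ j) (<⇒≢ l<j)
    = sym (+-identityʳ x)
  ... | tri≈ _ refl _
    rewrite dec-true (l <? suc l) (n<1+n l) | dec-false (l <? l) (<-irrefl refl) | dec-true (l ≟ l) refl
    = refl
  ... | tri> _ _ j<l
    rewrite dec-false (l <? suc j) (<⇒≱ j<l ∘ s≤s⁻¹) | dec-false (l <? j) (<-asym j<l)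
          | dec-false (l ≟ j) (>⇒≢ j<l)
    = refl

below-even : ∀ {L} (lab : Fin L → ℕ) g j → (∀ q → q < j → 2 ∣ ∑⟨ block lab q ⟩ g) → 2 ∣ ∑⟨ below lab j ⟩ g
below-even {L} lab g zero    _    = subst (2 ∣_) (sym (sum-replicate-zero L)) (2 ∣0)
below-even     lab g (suc j) even = subst (2 ∣_) (sym (∑⟨below-suc⟩ lab j g))
  (∣m∣n⇒∣m+n (below-even lab g j λ q q<j → even q (m<n⇒m<1+n q<j)) (even j (n<1+n j)))

below-⊑ : ∀ {L} (lab : Fin L → ℕ) {a b} → a ≤ b → below lab a ⊑ below lab b
below-⊑ lab a≤b p p∈a = dec-true (lab p <? _) (<-≤-trans (dec-true⁻¹ (lab p <? _) p∈a) a≤b)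

zero-sum-union : ∀ {L w} (val : Fin L → Fin (suc w) → ℕ) n .{{_ : NonZero n}} (lab : Fin L → ℕ) →
                 (∀ q → q < n → Good val (block lab q)) →
                 ∃ λ V → Nonempty V × (∀ i → 2 ∣ ∑⟨ V ⟩ (λ p → val p (suc i)))
                         × 2 * n ∣ ∑⟨ V ⟩ (λ p → val p zero)
zero-sum-union {L} val n lab good
  with a , b , a<b , b≤n , Ha≡Hb ← pigeonhole-% n (λ j → ∑⟨ below lab j ⟩ (λ p → val p zero) / 2)
  = V , V-nonempty , V-even , V-cyclic
  where
  g₀ : Fin L → ℕ
  g₀ p = val p zero
  T : ℕ → (Fin L → ℕ) → ℕ
  T j = ∑⟨ below lab j ⟩
  H : ℕ → ℕ
  H j = T j g₀ / 2
  a≤n = ≤-trans (<⇒≤ a<b) b≤n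
  T-even : ∀ j → j ≤ n → ∀ i → 2 ∣ T j (λ p → val p i)
  T-even j j≤n i = below-even lab _ j λ q q<j → proj₂ (good q (<-≤-trans q<j j≤n)) i
  T≡2H : ∀ j → j ≤ n → T j g₀ ≡ 2 * H j
  T≡2H j j≤n = sym (m*[n/m]≡n (T-even j j≤n zero))
  V : Mask L
  V = below lab b ∖ below lab a
  Ta+V≡Tb : ∀ g → T a g + ∑⟨ V ⟩ g ≡ T b g
  Ta+V≡Tb g = ∑⟨∖⟩ (below lab b) (below lab a) g (below-⊑ lab (<⇒≤ a<b))
  V-even : ∀ i → 2 ∣ ∑⟨ V ⟩ (λ p → val p (suc i))
  V-even i = ∣m+n∣m⇒∣n (subst (2 ∣_) (sym (Ta+V≡Tb _)) (T-even b b≤n (suc i))) (T-even a a≤n (suc i))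
  V≡2[Hb∸Ha] : ∑⟨ V ⟩ g₀ ≡ 2 * (H b ∸ H a)
  V≡2[Hb∸Ha] = begin
    ∑⟨ V ⟩ g₀                   ≡⟨ m+n∸m≡n (T a g₀) _ ⟨
    T a g₀ + ∑⟨ V ⟩ g₀ ∸ T a g₀ ≡⟨ cong₂ _∸_ (Ta+V≡Tb g₀) (T≡2H a a≤n) ⟩
    T b g₀ ∸ 2 * H a            ≡⟨ cong (_∸ 2 * H a) (T≡2H b b≤n) ⟩
    2 * H b ∸ 2 * H a           ≡⟨ *-distribˡ-∸ 2 (H b) (H a) ⟨
    2 * (H b ∸ H a)             ∎
    where open ≡-Reasoning
  V-cyclic : 2 * n ∣ ∑⟨ V ⟩ g₀
  V-cyclic = subst (2 * n ∣_) (sym V≡2[Hb∸Ha]) (*-monoʳ-∣ 2 (m%n≡o%n⇒n∣o∸m (H a) (H b) n Ha≡Hb))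
  V-nonempty : Nonempty V
  V-nonempty with p , p∈a ← proj₁ (good a (<-≤-trans a<b b≤n)) = p , V∋p
    where
    V∋p : V p ≡ true
    V∋p rewrite dec-true⁻¹ (lab p ≟ a) p∈a | dec-true (a <? b) a<b | dec-false (a <? a) (<-irrefl refl) = refl

module _ {A : Set} where

  select : (xs : List A) → Mask (length xs) → List A
  select []       M = []
  select (x ∷ xs) M with M zero
  ... | true  = x ∷ select xs (M ∘ suc)
  ... | false = select xs (M ∘ suc)

  select-⊆ : (xs : List A) (M : Mask (length xs)) → select xs M ⊆ xs
  select-⊆ []       M = []
  select-⊆ (x ∷ xs) M with M zero
  ... | true  = refl ∷ select-⊆ xs (M ∘ suc)
  ... | false = x ∷ʳ select-⊆ xs (M ∘ suc)

  select-nonempty : (xs : List A) (M : Mask (length xs)) → Nonempty M → select xs M ≢ []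
  select-nonempty (x ∷ xs) M (zero  , x∈M) with M zero
  ... | true = λ ()
  select-nonempty (x ∷ xs) M (suc p , p∈M) with M zero
  ... | true  = λ ()
  ... | false = select-nonempty xs (M ∘ suc) (p , p∈M)

  sum-select : (g : A → ℕ) (xs : List A) (M : Mask (length xs)) →
               sum (map g (select xs M)) ≡ ∑⟨ M ⟩ (g ∘ lookup xs)
  sum-select g []       M = refl
  sum-select g (x ∷ xs) M with M zero
  ... | true  = cong (g x +_) (sum-select g xs (M ∘ suc))
  ... | false = sum-select g xs (M ∘ suc)

coordinates : ∀ {r n} (xs : List (Elem r n)) → Fin (length xs) → Fin (suc (r ∸ 1)) → ℕ
coordinates xs p zero    = toℕ (proj₂ (lookup xs p))
coordinates xs p (suc i) = toℕ (Vec.lookup (proj₁ (lookup xs p)) i)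

ZSProperty-bound : ∀ r n .{{_ : NonZero n}} t k → suc (r ∸ 1) < k * t → ZSProperty r n (n * (2 * t) + t * 2 ^ k)
ZSProperty-bound r n t k w<kt xs big
  with lab , blocks ← good-blocks (coordinates {r} {n} xs) t k w<kt n (λ _ → true)
                        (subst (_ ≤_) (sym size-full) big)
  with V , V-nonempty , V-even , V-cyclic
         ← zero-sum-union (coordinates {r} {n} xs) n lab (λ q q<n → proj₂ (blocks q q<n))
  = select xs V , select-⊆ xs V , select-nonempty xs V V-nonempty ,
    (λ i → subst (2 ∣_) (sym (sum-select (λ x → toℕ (Vec.lookup (proj₁ x) i)) xs V)) (V-even i)) ,
    subst (2 * n ∣_) (sym (sum-select (λ x → toℕ (proj₂ x)) xs V)) V-cyclic

m<n*[1+m/n] : ∀ m n .{{_ : NonZero n}} → m < n * suc (m / n)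
m<n*[1+m/n] m n = begin-strict
  m                   ≡⟨ m≡m%n+[m/n]*n m n ⟩
  m % n + m / n * n   <⟨ +-monoˡ-< (m / n * n) (m%n<n m n) ⟩
  n + m / n * n       ≡⟨ trans (cong (n +_) (*-comm (m / n) n)) (sym (*-suc n (m / n))) ⟩
  n * suc (m / n)     ∎
  where open ≤-Reasoning

n*[1+m/n]≤m+n : ∀ m n .{{_ : NonZero n}} → n * suc (m / n) ≤ m + n
n*[1+m/n]≤m+n m n = begin
  n * suc (m / n)     ≡⟨ trans (*-suc n (m / n)) (cong (n +_) (*-comm n (m / n))) ⟩
  n + m / n * n       ≤⟨ +-monoʳ-≤ n (m/n*n≤m m n) ⟩
  n + m               ≡⟨ +-comm n m ⟩
  m + n               ∎
  where open ≤-Reasoning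

davenport-bound : ∀ {r n ℓ} k .{{_ : NonZero n}} .{{_ : NonZero k}} → 1 ≤ r → IsDavenport r n ℓ →
                  ℓ ≤ suc (r / k) * (2 * n + 2 ^ k)
davenport-bound {suc r} {n} {ℓ} k _ (_ , minimal) =
  subst (ℓ ≤_) (rearrange n t (2 ^ k)) (minimal _ (ZSProperty-bound (suc r) n t k (m<n*[1+m/n] (suc r) k)))
  where
  t = suc (suc r / k)
  rearrange : ∀ n t p → n * (2 * t) + t * p ≡ t * (2 * n + p)
  rearrange = solve-∀

1+n≤2^n : ∀ n → suc n ≤ 2 ^ n
1+n≤2^n zero    = s≤s z≤n
1+n≤2^n (suc n) = +-mono-≤ (m^n>0 2 n) (≤-trans (1+n≤2^n n) (m≤m+n (2 ^ n) 0))

-- From (1 + c)³ ≤ 8ᶜ at y = 3c, and each later step doubles the right side but adds only c to the left.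
linear≤exponential : ∀ c y → 3 * c ≤ y → c * suc y ≤ 2 ^ y
linear≤exponential c y 3c≤y with j , refl ← m≤n⇒∃[o]m+o≡n 3c≤y = go j
  where
  go : ∀ j → c * suc (3 * c + j) ≤ 2 ^ (3 * c + j)
  go zero = begin
    c * suc (3 * c + 0)                           ≤⟨ m≤m+n _ (c * c * c + 2 * c + 1) ⟩
    c * suc (3 * c + 0) + (c * c * c + 2 * c + 1) ≡⟨ cube c ⟩
    suc c * (suc c * suc c)                       ≤⟨ *-mono-≤ (1+n≤2^n c) (*-mono-≤ (1+n≤2^n c) (1+n≤2^n c)) ⟩
    2 ^ c * (2 ^ c * 2 ^ c)                       ≡⟨ cong (2 ^ c *_) (^-distribˡ-+-* 2 c c) ⟨
    2 ^ c * 2 ^ (c + c)                           ≡⟨ ^-distribˡ-+-* 2 c (c + c) ⟨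
    2 ^ (c + (c + c))                             ≡⟨ cong (2 ^_) (three c) ⟩
    2 ^ (3 * c + 0)                               ∎
    where
    open ≤-Reasoning
    cube : ∀ c → c * suc (3 * c + 0) + (c * c * c + 2 * c + 1) ≡ suc c * (suc c * suc c)
    cube = solve-∀
    three : ∀ c → c + (c + c) ≡ 3 * c + 0
    three = solve-∀
  go (suc j) = begin
    c * suc (3 * c + suc j)           ≡⟨ cong (λ z → c * suc z) (+-suc (3 * c) j) ⟩
    c * suc (suc (3 * c + j))         ≡⟨ *-suc c (suc (3 * c + j)) ⟩
    c + c * suc (3 * c + j)           ≤⟨ +-mono-≤ (≤-trans (m≤m*n c (suc (3 * c + j))) (go j)) (go j) ⟩
    2 ^ (3 * c + j) + 2 ^ (3 * c + j) ≡⟨ cong (2 ^ (3 * c + j) +_) (+-identityʳ _) ⟨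
    2 ^ suc (3 * c + j)               ≡⟨ cong (2 ^_) (+-suc (3 * c) j) ⟨
    2 ^ (3 * c + suc j)               ∎
    where open ≤-Reasoning

log₂-bracket : ∀ n → 1 ≤ n → ∃ λ x → n < 2 ^ x × 2 ^ x ≤ 2 * n
log₂-bracket (suc zero) _ = 1 , s≤s (s≤s z≤n) , ≤-refl
log₂-bracket (suc (suc m)) _
  with x , m+1<2^x , 2^x≤2[m+1] ← log₂-bracket (suc m) (s≤s z≤n)
  with suc (suc m) <? 2 ^ x
... | yes m+2<2^x = x , m+2<2^x , ≤-trans 2^x≤2[m+1] (*-monoʳ-≤ 2 (n≤1+n (suc m)))
... | no  m+2≮2^x =
  suc x , subst (_< 2 ^ suc x) (sym m+2≡2^x) (m<m+n (2 ^ x) (subst (0 <_) (sym (+-identityʳ _)) (m^n>0 2 x))) ,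
  ≤-reflexive (cong (2 *_) (sym m+2≡2^x))
  where
  m+2≡2^x : suc (suc m) ≡ 2 ^ x
  m+2≡2^x = ≤-antisym m+1<2^x (≮⇒≥ m+2≮2^x)

2^m<2^n⇒m<n : ∀ {m n} → 2 ^ m < 2 ^ n → m < n
2^m<2^n⇒m<n {m} {n} 2^m<2^n with m <? n
... | yes m<n = m<n
... | no  m≮n = contradiction (^-monoʳ-≤ 2 (≮⇒≥ m≮n)) (<⇒≱ 2^m<2^n)

2^[x∸1]≤n : ∀ {x n} → 1 ≤ x → 2 ^ x ≤ 2 * n → 2 ^ (x ∸ 1) ≤ n
2^[x∸1]≤n {suc x} _ = *-cancelˡ-≤ 2

-- With k = ⌊Bx/A⌋ + 1 one gets x ≤ A(y + 1) for y = x − k, so x ≥ A(3BA + 1) forces y ≥ 3BA,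
-- where linear≤exponential gives Bx ≤ BA(y + 1) ≤ 2^y.
block-width : ∀ B A → B < A → ∃[ X ] (2 ≤ X × ∀ x → X ≤ x →
              ∃[ k ] (NonZero k × B * x < A * k × B * x * 2 ^ k ≤ 2 ^ x))
block-width B A B<A = A * suc (3 * (B * A)) + 2 , m≤n+m 2 _ , width
  where
  instance
    A≢0 : NonZero A
    A≢0 = >-nonZero (≤-trans (s≤s z≤n) B<A)
  width : ∀ x → A * suc (3 * (B * A)) + 2 ≤ x → ∃[ k ] (NonZero k × B * x < A * k × B * x * 2 ^ k ≤ 2 ^ x)
  width x X≤x = k , _ , m<n*[1+m/n] (B * x) A , Bx2^k≤2^x
    where
    k = suc (B * x / A)
    Ak≤Bx+A : A * k ≤ B * x + A
    Ak≤Bx+A = n*[1+m/n]≤m+n (B * x) A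
    A≤x : A ≤ x
    A≤x = ≤-trans (≤-trans (m≤m*n A (suc (3 * (B * A)))) (m≤m+n _ 2)) X≤x
    [1+B]x≤Ax : x + B * x ≤ A * x
    [1+B]x≤Ax = *-monoˡ-≤ x B<A
    k≤x : k ≤ x
    k≤x = *-cancelˡ-≤ A (begin
      A * k         ≤⟨ Ak≤Bx+A ⟩
      B * x + A     ≤⟨ +-monoʳ-≤ (B * x) A≤x ⟩
      B * x + x     ≡⟨ +-comm (B * x) x ⟩
      x + B * x     ≤⟨ [1+B]x≤Ax ⟩
      A * x         ∎)
      where open ≤-Reasoning
    y = x ∸ k
    x≤A[1+y] : x ≤ A * suc y
    x≤A[1+y] = +-cancelʳ-≤ (B * x) x (A * suc y) (begin
      x + B * x             ≤⟨ [1+B]x≤Ax ⟩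
      A * x                 ≡⟨ cong (A *_) (m∸n+n≡m k≤x) ⟨
      A * (y + k)           ≡⟨ *-distribˡ-+ A y k ⟩
      A * y + A * k         ≤⟨ +-monoʳ-≤ (A * y) Ak≤Bx+A ⟩
      A * y + (B * x + A)   ≡⟨ regroup (A * y) (B * x) A ⟩
      A * y + A + B * x     ≡⟨ cong (_+ B * x) (trans (+-comm (A * y) A) (sym (*-suc A y))) ⟩
      A * suc y + B * x     ∎)
      where
      open ≤-Reasoning
      regroup : ∀ u v w → u + (v + w) ≡ u + w + v
      regroup = solve-∀
    3BA≤y : 3 * (B * A) ≤ y
    3BA≤y = s≤s⁻¹ (*-cancelˡ-≤ A (≤-trans (m≤m+n _ 2) (≤-trans X≤x x≤A[1+y])))
    Bx2^k≤2^x : B * x * 2 ^ k ≤ 2 ^ x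
    Bx2^k≤2^x = begin
      B * x * 2 ^ k           ≤⟨ *-monoˡ-≤ (2 ^ k) (*-monoʳ-≤ B x≤A[1+y]) ⟩
      B * (A * suc y) * 2 ^ k ≡⟨ cong (_* 2 ^ k) (*-assoc B A (suc y)) ⟨
      B * A * suc y * 2 ^ k   ≤⟨ *-monoˡ-≤ (2 ^ k) (linear≤exponential (B * A) y 3BA≤y) ⟩
      2 ^ y * 2 ^ k           ≡⟨ ^-distribˡ-+-* 2 y k ⟨
      2 ^ (y + k)             ≡⟨ cong (2 ^_) (m∸n+n≡m k≤x) ⟩
      2 ^ x                   ∎
      where open ≤-Reasoning

density-bound : ∀ {A B x n k} → B * x < A * k → B * x * 2 ^ k ≤ 2 ^ x → 2 ^ x ≤ 2 * n →
                B * x * (2 * n + 2 ^ k) ≤ 2 * n * (A * k)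
density-bound {A} {B} {x} {n} {k} Bx<Ak Bx2^k≤2^x 2^x≤2n = begin
  B * x * (2 * n + 2 ^ k)          ≡⟨ *-distribˡ-+ (B * x) (2 * n) (2 ^ k) ⟩
  B * x * (2 * n) + B * x * 2 ^ k  ≤⟨ +-monoʳ-≤ (B * x * (2 * n)) (≤-trans Bx2^k≤2^x 2^x≤2n) ⟩
  B * x * (2 * n) + 2 * n          ≡⟨ trans (+-comm _ (2 * n)) (cong (2 * n +_) (*-comm (B * x) (2 * n))) ⟩
  2 * n + 2 * n * (B * x)          ≡⟨ *-suc (2 * n) (B * x) ⟨
  2 * n * suc (B * x)              ≤⟨ *-monoʳ-≤ (2 * n) Bx<Ak ⟩
  2 * n * (A * k)                  ∎
  where open ≤-Reasoning

exponent-bound : ∀ {A B C D x n k r ℓ} .{{_ : NonZero k}} → 2 ≤ x → 1 ≤ C →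
                 ℓ ≤ suc (r / k) * (2 * n + 2 ^ k) →
                 B * x * (2 * n + 2 ^ k) ≤ 2 * n * (A * k) →
                 x * D * (2 * n + 2 ^ k) ≤ r →
                 x * (B * D * ℓ) ≤ 2 * (D * A * r * n) + (x ∸ 1) * (B * C * r)
exponent-bound {A} {B} {C} {D} {x} {n} {k} {r} {ℓ} 2≤x 1≤C ℓ≤tQ density r-big = *-cancelˡ-≤ k (begin
  k * (x * (B * D * ℓ))                      ≤⟨ *-monoʳ-≤ k (*-monoʳ-≤ x (*-monoʳ-≤ (B * D) ℓ≤tQ)) ⟩
  k * (x * (B * D * (t * Q)))                ≡⟨ e₁ k x B D t Q ⟩
  B * x * Q * D * (k * t)                    ≤⟨ *-monoʳ-≤ (B * x * Q * D) (n*[1+m/n]≤m+n r k) ⟩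
  B * x * Q * D * (r + k)                    ≡⟨ e₂ B x Q D r k ⟩
  B * x * Q * (D * r) + x * D * Q * (B * k)  ≤⟨ +-mono-≤ (*-monoˡ-≤ (D * r) density) (*-monoˡ-≤ (B * k) r-big) ⟩
  2 * n * (A * k) * (D * r) + r * (B * k)    ≡⟨ e₃ n A k D r B ⟩
  k * (2 * (D * A * r * n) + 1 * (B * 1 * r)) ≤⟨ *-monoʳ-≤ k (+-monoʳ-≤ _ Br≤[x-1]BCr) ⟩
  k * (2 * (D * A * r * n) + (x ∸ 1) * (B * C * r)) ∎)
  where
  open ≤-Reasoning
  t = suc (r / k)
  Q = 2 * n + 2 ^ k
  Br≤[x-1]BCr : 1 * (B * 1 * r) ≤ (x ∸ 1) * (B * C * r)
  Br≤[x-1]BCr = *-mono-≤ (∸-monoˡ-≤ 1 2≤x) (*-monoˡ-≤ r (*-monoʳ-≤ B 1≤C))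
  e₁ : ∀ k x B D t Q → k * (x * (B * D * (t * Q))) ≡ B * x * Q * D * (k * t)
  e₁ = solve-∀
  e₂ : ∀ B x Q D r k → B * x * Q * D * (r + k) ≡ B * x * Q * (D * r) + x * D * Q * (B * k)
  e₂ = solve-∀
  e₃ : ∀ n A k D r B → 2 * n * (A * k) * (D * r) + r * (B * k) ≡ k * (2 * (D * A * r * n) + 1 * (B * 1 * r))
  e₃ = solve-∀

power-bound : ∀ {n x e f g} → n ≤ 2 ^ x → 2 ^ (x ∸ 1) ≤ n → x * e ≤ 2 * f + (x ∸ 1) * g → n ^ e ≤ 4 ^ f * n ^ g
power-bound {n} {x} {e} {f} {g} n≤2^x 2^[x-1]≤n xe≤ = begin
  n ^ e                             ≤⟨ ^-monoˡ-≤ e n≤2^x ⟩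
  (2 ^ x) ^ e                       ≡⟨ ^-*-assoc 2 x e ⟩
  2 ^ (x * e)                       ≤⟨ ^-monoʳ-≤ 2 xe≤ ⟩
  2 ^ (2 * f + (x ∸ 1) * g)         ≡⟨ ^-distribˡ-+-* 2 (2 * f) ((x ∸ 1) * g) ⟩
  2 ^ (2 * f) * 2 ^ ((x ∸ 1) * g)   ≡⟨ cong₂ _*_ (^-*-assoc 2 2 f) (^-*-assoc 2 (x ∸ 1) g) ⟨
  4 ^ f * (2 ^ (x ∸ 1)) ^ g         ≤⟨ *-monoʳ-≤ (4 ^ f) (^-monoˡ-≤ g 2^[x-1]≤n) ⟩
  4 ^ f * n ^ g                     ∎
  where open ≤-Reasoning

davenport-power-bound : ∀ {A B C D n x k} .{{_ : NonZero n}} .{{_ : NonZero k}} → 2 ≤ x → 1 ≤ C → 1 ≤ D →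
                        n < 2 ^ x → 2 ^ x ≤ 2 * n → B * x < A * k → B * x * 2 ^ k ≤ 2 ^ x →
                        ∀ r → x * D * (2 * n + 2 ^ k) ≤ r → ∀ ℓ → IsDavenport r n ℓ →
                        n ^ (B * D * ℓ) ≤ 4 ^ (D * A * r * n) * n ^ (B * C * r)
davenport-power-bound {A} {B} {C} {D} {n} {x} {k} 2≤x 1≤C 1≤D n<2^x 2^x≤2n Bx<Ak Bx2^k≤2^x r R≤r ℓ dav =
  power-bound {n} {x} {B * D * ℓ} {D * A * r * n} (<⇒≤ n<2^x) (2^[x∸1]≤n (<⇒≤ 2≤x) 2^x≤2n)
    (exponent-bound {A} {B} {C} {D} {x} {n} {k} {r} {ℓ} 2≤x 1≤C (davenport-bound k 1≤r dav)
                    (density-bound {A} {B} {x} {n} {k} Bx<Ak Bx2^k≤2^x 2^x≤2n) R≤r)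
  where
  1≤r : 1 ≤ r
  1≤r = ≤-trans (*-mono-≤ (*-mono-≤ (<⇒≤ 2≤x) 1≤D) (≤-trans (m^n>0 2 k) (m≤n+m _ _))) R≤r

corollary4 : (a b : ℕ) → ∃[ N ] ((n : ℕ) → N ≤ n → (c d : ℕ) → ∃[ R ] ((r : ℕ) → R ≤ r →
    (ℓ : ℕ) → IsDavenport r n ℓ →
    n ^ (suc b * suc d * ℓ) ≤ 4 ^ (suc d * (suc b + suc a) * r * n) * n ^ (suc b * suc c * r)))
corollary4 a b with X , 2≤X , width ← block-width (suc b) (suc b + suc a) (m<m+n (suc b) (s≤s z≤n)) = 2 ^ X , bound
  where
  bound : (n : ℕ) → 2 ^ X ≤ n → (c d : ℕ) → ∃[ R ] ((r : ℕ) → R ≤ r → (ℓ : ℕ) → IsDavenport r n ℓ →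
          n ^ (suc b * suc d * ℓ) ≤ 4 ^ (suc d * (suc b + suc a) * r * n) * n ^ (suc b * suc c * r))
  bound zero 2^X≤0 = contradiction 2^X≤0 (<⇒≱ (m^n>0 2 X))
  bound n@(suc _) 2^X≤n c d
    with x , n<2^x , 2^x≤2n ← log₂-bracket n (s≤s z≤n)
    with X<x ← 2^m<2^n⇒m<n (≤-<-trans 2^X≤n n<2^x)
    with k , k≢0 , Bx<Ak , Bx2^k≤2^x ← width x (<⇒≤ X<x)
    = x * suc d * (2 * n + 2 ^ k) ,
      davenport-power-bound {suc b + suc a} {suc b} {suc c} {suc d} {{_}} {{k≢0}}
        (≤-trans 2≤X (<⇒≤ X<x)) (s≤s z≤n) (s≤s z≤n) n<2^x 2^x≤2n Bx<Ak Bx2^k≤2^x
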